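{- For every ordinal $\alpha<\omega^2$ (and any choice of the fundamental sequences $\{\lambda\}$), $\mathrm{rk}(T_\alpha,p(x))=\alpha$.
   Context: For each countable limit ordinal $\lambda$ fix a strictly increasing $\{\lambda\}:\omega\to\lambda$ with supremum $\lambda$. Trees are subsets of $\omega^{<\omega}$ closed under initial segments; $\epsilon$ is the empty sequence and $s^\frown t$ concatenation (a number $i$ is identified with $\langle i\rangle$). Define $\tau_0=\{\epsilon\}$, $\tau_{\alpha+1}=\{\epsilon\}\cup\{i^\frown s:i\in\omega,s\in\tau_\alpha\}$, $\tau_\lambda=\{\epsilon\}\cup\{i^\frown s:i\in\omega,s\in\tau_{\{\lambda\}(i)}\}$ for limit $\lambda$. For a well-founded tree $\tau$, $\mathrm{rk}_\tau(s)=\sup_i(\mathrm{rk}_\tau(s^\frown i)+1)$ if $s\in\tau$ and $-1$ otherwise. $T_\alpha$ is the theory in the language $\{P_s:s\in\tau_\alpha,s\neq\epsilon\}\cup\{U_i:i\in\omega\}$ (all unary predicates) with axioms: $\neg\exists xP_{s^\frown i}(x)\to\forall x(P_s(x)\to U_i(x))$ for $s^\frown i\in\tau_\alpha$, $s\neq\epsilon$; $\forall x(P_s(x)\to U_i(x))$ for all $i$ and all $s$ with $\mathrm{rk}_{\tau_\alpha}(s)=0$; and $\exists^{\ge i}x\bigwedge_{j\le i}U_j(x)$ for all $i$. Let $p(x)=\{U_i(x):i\in\omega\}$. For a theory $S$, $\mathrm{Th}(S)$ is its deductive closure, $(S)^p=\{\neg\exists x\varphi(x):S\models\forall x(\varphi(x)\to\psi(x))\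 \forall\psi\in p\}$, $[S]^p=\mathrm{Th}(S+(S)^p)$; $[T]^p_0=\mathrm{Th}(T)$, $[T]^p_{\beta+1}=[[T]^p_\beta]^p$, unions at limits, $[T]^p_\infty=\bigcup_\beta[T]^p_\beta$; $\mathrm{rk}(T,p)$ is the least $\beta$ with $[T]^p_\beta=[T]^p_\infty$. -}

module Defs where

open import Data.Nat using (ℕ; zero; suc; _≤_; _<_)
open import Data.Fin using (Fin; zero; suc)
open import Data.List using (List; []; _∷_; _++_; [_]; foldr; allFin)
open import Data.Bool using (Bool; true; false; T)
open import Data.Product using (Σ; _×_; _,_; ∃; proj₁; proj₂)
open import Data.Sum using (_⊎_; inj₁; inj₂)
open import Relation.Nullary using (¬_)
open import Relation.Binary.PropositionalEquality using (_≡_)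

-- Deductive closure is given by a standard Hilbert calculus
-- (nonempty domains, as usual in model theory).

module FOL (L : Set) where

  infixr 4 _⇒_
  infix 6 _≐_

  data Formula (n : ℕ) : Set where
    rel  : L → Fin n → Formula n
    _≐_  : Fin n → Fin n → Formula n
    ⊥'   : Formula n
    _⇒_  : Formula n → Formula n → Formula n
    ∀'   : Formula (suc n) → Formula n

  ext : ∀ {n m} → (Fin n → Fin m) → Fin (suc n) → Fin (suc m)
  ext ρ zero    = zero
  ext ρ (suc i) = suc (ρ i)

  ren : ∀ {n m} → (Fin n → Fin m) → Formula n → Formula m
  ren ρ (rel r t) = rel r (ρ t)
  ren ρ (t ≐ u)   = ρ t ≐ ρ u
  ren ρ ⊥'        = ⊥'
  ren ρ (φ ⇒ ψ)   = ren ρ φ ⇒ ren ρ ψ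
  ren ρ (∀' φ)    = ∀' (ren (ext ρ) φ)

  ¬' : ∀ {n} → Formula n → Formula n
  ¬' φ = φ ⇒ ⊥'

  ⊤' : ∀ {n} → Formula n
  ⊤' = ⊥' ⇒ ⊥'

  _∧'_ : ∀ {n} → Formula n → Formula n → Formula n
  φ ∧' ψ = ¬' (φ ⇒ ¬' ψ)

  ∃' : ∀ {n} → Formula (suc n) → Formula n
  ∃' φ = ¬' (∀' (¬' φ))

  wk : ∀ {n} → Formula n → Formula (suc n)
  wk = ren suc

  sub0 : ∀ {n} → Fin n → Formula (suc n) → Formula n
  sub0 {n} t = ren σ
    where
    σ : Fin (suc n) → Fin n
    σ zero    = t
    σ (suc i) = i

  close : ∀ {n} → Formula 0 → Formula n
  close = ren (λ ())

  Theory : Set₁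
  Theory = Formula 0 → Set

  infix 2 _⊢_
  data _⊢_ (S : Theory) : {n : ℕ} → Formula n → Set where
    hyp    : ∀ {n} {σ : Formula 0} → S σ → S ⊢ close {n} σ
    axK    : ∀ {n} (φ ψ : Formula n) → S ⊢ φ ⇒ ψ ⇒ φ
    axS    : ∀ {n} (φ ψ χ : Formula n) →
             S ⊢ (φ ⇒ ψ ⇒ χ) ⇒ (φ ⇒ ψ) ⇒ φ ⇒ χ
    axDN   : ∀ {n} (φ : Formula n) → S ⊢ ¬' (¬' φ) ⇒ φ
    mp     : ∀ {n} {φ ψ : Formula n} → S ⊢ φ ⇒ ψ → S ⊢ φ → S ⊢ ψ
    ∀elim  : ∀ {n} (φ : Formula (suc n)) (t : Fin n) → S ⊢ ∀' φ ⇒ sub0 t φ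
    ∀dist  : ∀ {n} (ψ : Formula n) (φ : Formula (suc n)) →
             S ⊢ ∀' (wk ψ ⇒ φ) ⇒ ψ ⇒ ∀' φ
    gen    : ∀ {n} {φ : Formula (suc n)} → S ⊢ φ → S ⊢ ∀' φ
    nonemp : ∀ {n} (χ : Formula n) → S ⊢ ∀' (wk χ) ⇒ χ
    eqRefl : ∀ {n} (t : Fin n) → S ⊢ t ≐ t
    eqSubst : ∀ {n} (φ : Formula (suc n)) (t u : Fin n) →
             S ⊢ (t ≐ u) ⇒ sub0 t φ ⇒ sub0 u φ

  Th : Theory → Theory
  Th S σ = S ⊢ σ

  _⊆_ : Theory → Theory → Set
  S ⊆ S' = ∀ σ → S σ → S' σ

  -- ∃^{≥ i} x φ(x): there are i pairwise distinct elements satisfying φ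
  neqAll : (k : ℕ) → Formula (suc k)
  neqAll k = foldr (λ j acc → ¬' (zero ≐ suc j) ∧' acc) ⊤' (allFin k)

  atLeastGo : Formula 1 → (k r : ℕ) → Formula k
  atLeastGo φ k zero    = ⊤'
  atLeastGo φ k (suc r) =
    ∃' (neqAll k ∧' (ren (λ _ → zero) φ ∧' atLeastGo φ (suc k) r))

  atLeast : ℕ → Formula 1 → Formula 0
  atLeast i φ = atLeastGo φ 0 i

-- Ordinals below ω² : (m , n) stands for ω·m + n

Ord : Set
Ord = ℕ × ℕ

infix 4 _<o_ _≤o_
data _<o_ : Ord → Ord → Set where
  lt₁ : ∀ {m n m' n'} → m < m' → (m , n) <o (m' , n')
  lt₂ : ∀ {m n n'} → n < n' → (m , n) <o (m , n')

_≤o_ : Ord → Ord → Set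
α ≤o β = α <o β ⊎ α ≡ β

-- A choice of fundamental sequences for all limit ordinals below ω²:
-- seq m is {λ} for λ = ω·(suc m): strictly increasing, below λ, sup = λ.
record FundSeq : Set where
  field
    seq      : ℕ → ℕ → Ord
    bounded  : ∀ m i → seq m i <o (suc m , 0)
    strict   : ∀ m i j → i < j → seq m i <o seq m j
    cofinal  : ∀ m β → β <o (suc m , 0) → ∃ λ i → β <o seq m i
open FundSeq public

inTau : FundSeq → Ord → List ℕ → Bool
inTau F _ [] = true
inTau F (zero , zero)  (i ∷ s) = false
inTau F (m , suc n)    (i ∷ s) = inTau F (m , n) s
inTau F (suc m , zero) (i ∷ s) = inTau F (seq F m i) s

-- the language of T_α: P_s for s ∈ τ_α, s ≠ ε (written s = j ∷ s'),
-- and U_i for i ∈ ω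
Sym : FundSeq → Ord → Set
Sym F α = (Σ ℕ λ j → Σ (List ℕ) λ s → T (inTau F α (j ∷ s))) ⊎ ℕ

module TheoryT (F : FundSeq) (α : Ord) where
  open FOL (Sym F α) public

  P : (j : ℕ) (s : List ℕ) → T (inTau F α (j ∷ s)) → Formula 1
  P j s h = rel (inj₁ (j , s , h)) zero

  U : ℕ → Formula 1
  U i = rel (inj₂ i) zero

  bigU : ℕ → Formula 1
  bigU zero    = U zero
  bigU (suc i) = bigU i ∧' U (suc i)

  -- the axioms of T_α.  "rk_{τ_α}(s) = 0" unfolds to: s ∈ τ_α and no
  -- s⌢k lies in τ_α.
  data TAx : Theory where
    ax-branch : ∀ j s i (h₁ : T (inTau F α (j ∷ s ++ [ i ])))
                (h₂ : T (inTau F α (j ∷ s))) →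
                TAx (¬' (∃' (P j (s ++ [ i ]) h₁)) ⇒ ∀' (P j s h₂ ⇒ U i))
    ax-leaf   : ∀ j s (h : T (inTau F α (j ∷ s))) →
                (∀ k → ¬ T (inTau F α (j ∷ s ++ [ k ]))) →
                ∀ i → TAx (∀' (P j s h ⇒ U i))
    ax-inf    : ∀ i → TAx (atLeast i (bigU i))

  -- (S)^p for p(x) = {U_i(x) : i ∈ ω}
  Pp : Theory → Theory
  Pp S σ = Σ (Formula 1) λ φ → (σ ≡ ¬' (∃' φ)) × (∀ i → S ⊢ ∀' (φ ⇒ U i))

  brk : Theory → Theory
  brk S = Th (λ σ → S σ ⊎ Pp S σ)

  -- [T_α]^p_β for β = ω·m + n ; below m = ⋃_{γ < ω·(suc m)} [T_α]^p_γ
  mutual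
    lev : ℕ → ℕ → Theory
    lev zero    zero    = Th TAx
    lev (suc m) zero    = below m
    lev m       (suc n) = brk (lev m n)

    below : ℕ → Theory
    below zero    σ = Σ ℕ λ k → lev zero k σ
    below (suc m) σ = below m σ ⊎ (Σ ℕ λ k → lev (suc m) k σ)

  Iter : Ord → Theory
  Iter β = lev (proj₁ β) (proj₂ β)

-- Let TAx⁺ be T_α together with ¬∃x P_s(x) for every s ∈ τ_α.  The axiom for s
-- enters [T_α]^p at stage rk(s) + 1 ≤ α, by induction on rk(s).  Conversely TAx⁺ is closed under
-- (_)^p: if it proves ∀x (ψ(x) → U_i(x)) for every i, pick N beyond the symbols of ψ and
-- relativize U_N to elements ≠ y.  The relativized axioms remain provable (the P-axioms are
-- vacuous and ∃^{≥ i+1} yields the relativized ∃^{≥ i}), so ψ(y) → y ≠ y.  Hence every stage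
-- lies in Th(TAx⁺) ⊆ [T_α]^p_α.  Structures realizing P_t only at nodes t of rank ≥ β satisfy [T_α]^p_β; the
-- successor step is a surgery on such a structure.  Filling every P_t of rank ≥ β gives a model
-- of [T_α]^p_β refuting ¬∃x P_s(x) for a node s of rank β, which [T_α]^p_α proves.
module Submission where

open import Defs
open import Data.Nat
  using (ℕ; zero; suc; _≤_; _<_; _≤′_; ≤′-refl; ≤′-step; z≤n; s≤s; _+_; _≟_; _<?_)
open import Data.Nat.Properties
  using (≤-trans; ≤-refl; <-trans; <-irrefl; ≤-pred; n<1+n; <⇒≤; ≤∧≢⇒<; m≤m+n; m≤n+m; ≤⇒≤′)
open import Data.Nat.Induction using (<-wellFounded)
open import Data.Nat.ListAction using (sum)
open import Data.Fin using (Fin; zero; suc; inject₁; fromℕ)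
open import Data.List using (List; []; _∷_; _++_; [_]; foldr; allFin; map; applyUpTo)
open import Data.List.Membership.Propositional using (_∈_; _∉_)
open import Data.List.Membership.Propositional.Properties
  using (∈-map⁺; ∈-allFin; ∈-++⁺ʳ; ∈-applyUpTo⁺)
open import Data.List.Relation.Unary.Any using (here; there)
open import Data.List.Relation.Binary.Subset.Propositional using () renaming (_⊆_ to _⊆ᴸ_)
open import Data.List.Relation.Binary.Subset.Propositional.Properties
  using (xs⊆x∷xs; ∷⁺ʳ) renaming (map⁺ to ⊆ᴸ-map⁺)
open import Data.Bool using (Bool; true; false; T; _∧_)
open import Data.Bool.Properties using (T-∧)
open import Data.Product using (Σ; _×_; _,_; ∃; proj₁; proj₂)
open import Data.Product.Relation.Binary.Lex.Strict using (×-wellFounded)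
open import Data.Sum using (_⊎_; inj₁; inj₂)
open import Data.Empty using (⊥; ⊥-elim)
open import Data.Unit using (⊤; tt)
open import Function.Bundles using (Equivalence)
open import Induction.WellFounded using (Acc; acc; WellFounded; module Subrelation)
open import Relation.Nullary using (¬_; yes; no; Dec)
open import Relation.Binary.PropositionalEquality hiding ([_])

module Syntax (L : Set) where
  open FOL L

  ext-cong : ∀ {n m} {ρ ρ' : Fin n → Fin m} → (∀ i → ρ i ≡ ρ' i) → ∀ i → ext ρ i ≡ ext ρ' i
  ext-cong e zero    = refl
  ext-cong e (suc i) = cong suc (e i)

  ren-cong : ∀ {n m} {ρ ρ' : Fin n → Fin m} → (∀ i → ρ i ≡ ρ' i) → ∀ φ → ren ρ φ ≡ ren ρ' φ
  ren-cong e (rel r t) = cong (rel r) (e t)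
  ren-cong e (t ≐ u)   = cong₂ _≐_ (e t) (e u)
  ren-cong e ⊥'        = refl
  ren-cong e (φ ⇒ ψ)   = cong₂ _⇒_ (ren-cong e φ) (ren-cong e ψ)
  ren-cong e (∀' φ)    = cong ∀' (ren-cong (ext-cong e) φ)

  ren-∘ : ∀ {n m k} (ρ : Fin m → Fin k) (ρ' : Fin n → Fin m) φ →
          ren ρ (ren ρ' φ) ≡ ren (λ i → ρ (ρ' i)) φ
  ren-∘ ρ ρ' (rel r t) = refl
  ren-∘ ρ ρ' (t ≐ u)   = refl
  ren-∘ ρ ρ' ⊥'        = refl
  ren-∘ ρ ρ' (φ ⇒ ψ)   = cong₂ _⇒_ (ren-∘ ρ ρ' φ) (ren-∘ ρ ρ' ψ)
  ren-∘ ρ ρ' (∀' φ)    =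
    cong ∀' (trans (ren-∘ (ext ρ) (ext ρ') φ) (ren-cong (λ { zero → refl ; (suc i) → refl }) φ))

  ren-id : ∀ {n} {ρ : Fin n → Fin n} → (∀ i → ρ i ≡ i) → ∀ φ → ren ρ φ ≡ φ
  ren-id e φ = trans (ren-cong e φ) (ren-id-refl φ)
    where
    ren-id-refl : ∀ {n} (φ : Formula n) → ren (λ i → i) φ ≡ φ
    ren-id-refl (rel r t) = refl
    ren-id-refl (t ≐ u)   = refl
    ren-id-refl ⊥'        = refl
    ren-id-refl (φ ⇒ ψ)   = cong₂ _⇒_ (ren-id-refl φ) (ren-id-refl ψ)
    ren-id-refl (∀' φ)    =
      cong ∀' (trans (ren-cong (λ { zero → refl ; (suc i) → refl }) φ) (ren-id-refl φ))

  close-id : (σ : Formula 0) → close {0} σ ≡ σ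
  close-id = ren-id (λ ())

  ren-close : ∀ {n m} (ρ : Fin n → Fin m) σ → ren ρ (close {n} σ) ≡ close σ
  ren-close ρ σ = trans (ren-∘ ρ (λ ()) σ) (ren-cong (λ ()) σ)

  sub0-map : ∀ {n} → Fin n → Fin (suc n) → Fin n
  sub0-map t zero    = t
  sub0-map t (suc i) = i

  sub0-ren : ∀ {n} (t : Fin n) φ → sub0 t φ ≡ ren (sub0-map t) φ
  sub0-ren t = ren-cong (λ { zero → refl ; (suc i) → refl })

  ren-sub0 : ∀ {n m} (ρ : Fin n → Fin m) t φ → ren ρ (sub0 t φ) ≡ sub0 (ρ t) (ren (ext ρ) φ)
  ren-sub0 ρ t φ = begin
    ren ρ (sub0 t φ)                          ≡⟨ cong (ren ρ) (sub0-ren t φ) ⟩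
    ren ρ (ren (sub0-map t) φ)                ≡⟨ ren-∘ ρ (sub0-map t) φ ⟩
    ren (λ i → ρ (sub0-map t i)) φ            ≡⟨ ren-cong (λ { zero → refl ; (suc i) → refl }) φ ⟩
    ren (λ i → sub0-map (ρ t) (ext ρ i)) φ    ≡⟨ ren-∘ (sub0-map (ρ t)) (ext ρ) φ ⟨
    ren (sub0-map (ρ t)) (ren (ext ρ) φ)      ≡⟨ sub0-ren (ρ t) _ ⟨
    sub0 (ρ t) (ren (ext ρ) φ)                ∎
    where open ≡-Reasoning

  ren-wk : ∀ {n m} (ρ : Fin n → Fin m) φ → ren (ext ρ) (wk φ) ≡ wk (ren ρ φ)
  ren-wk ρ φ = trans (ren-∘ (ext ρ) suc φ) (sym (ren-∘ suc ρ φ))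

  sub0-zero-ext-suc : ∀ {n} (φ : Formula (suc n)) → sub0 zero (ren (ext suc) φ) ≡ φ
  sub0-zero-ext-suc φ = trans (sub0-ren zero _)
    (trans (ren-∘ (sub0-map zero) (ext suc) φ) (ren-id (λ { zero → refl ; (suc i) → refl }) φ))

  AllSymbols : (L → Set) → ∀ {n} → Formula n → Set
  AllSymbols G (rel r t) = G r
  AllSymbols G (t ≐ u)   = ⊤
  AllSymbols G ⊥'        = ⊤
  AllSymbols G (φ ⇒ ψ)   = AllSymbols G φ × AllSymbols G ψ
  AllSymbols G (∀' φ)    = AllSymbols G φ

  AllSymbols-map : ∀ {G G' : L → Set} → (∀ {r} → G r → G' r) →
                   ∀ {n} (φ : Formula n) → AllSymbols G φ → AllSymbols G' φ
  AllSymbols-map f (rel r t) g         = f g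
  AllSymbols-map f (t ≐ u)   g         = g
  AllSymbols-map f ⊥'        g         = g
  AllSymbols-map f (φ ⇒ ψ)   (gφ , gψ) = AllSymbols-map f φ gφ , AllSymbols-map f ψ gψ
  AllSymbols-map f (∀' φ)    g         = AllSymbols-map f φ g

  AllSymbols-ren : ∀ {G n m} (ρ : Fin n → Fin m) (φ : Formula n) →
                   AllSymbols G φ → AllSymbols G (ren ρ φ)
  AllSymbols-ren ρ (rel r t) g         = g
  AllSymbols-ren ρ (t ≐ u)   g         = g
  AllSymbols-ren ρ ⊥'        g         = g
  AllSymbols-ren ρ (φ ⇒ ψ)   (gφ , gψ) = AllSymbols-ren ρ φ gφ , AllSymbols-ren ρ ψ gψ
  AllSymbols-ren ρ (∀' φ)    g         = AllSymbols-ren (ext ρ) φ g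

  symbolBound : (L → ℕ) → ∀ {n} → Formula n → ℕ
  symbolBound f (rel r t) = f r
  symbolBound f (t ≐ u)   = 0
  symbolBound f ⊥'        = 0
  symbolBound f (φ ⇒ ψ)   = symbolBound f φ + symbolBound f ψ
  symbolBound f (∀' φ)    = symbolBound f φ

  symbolBound-AllSymbols : ∀ f {n} (φ : Formula n) {N} →
                           symbolBound f φ ≤ N → AllSymbols (λ r → f r ≤ N) φ
  symbolBound-AllSymbols f (rel r t) p = p
  symbolBound-AllSymbols f (t ≐ u)   p = tt
  symbolBound-AllSymbols f ⊥'        p = tt
  symbolBound-AllSymbols f (φ ⇒ ψ)   p =
    symbolBound-AllSymbols f φ (≤-trans (m≤m+n _ _) p) ,
    symbolBound-AllSymbols f ψ (≤-trans (m≤n+m _ _) p)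
  symbolBound-AllSymbols f (∀' φ)    p = symbolBound-AllSymbols f φ p

  neqList : ∀ {k} → List (Fin k) → Formula (suc k)
  neqList = foldr (λ j acc → ¬' (zero ≐ suc j) ∧' acc) ⊤'

  neqAll-AllSymbols : ∀ G k → AllSymbols G (neqAll k)
  neqAll-AllSymbols G k = go (allFin k)
    where
    go : (l : List (Fin k)) → AllSymbols G (neqList l)
    go []      = tt , tt
    go (j ∷ l) = ((tt , tt) , (go l , tt)) , tt

module Derivations (L : Set) where
  open FOL L
  open Syntax L

  module _ {S : Theory} where

    ⇒-refl : ∀ {n} (φ : Formula n) → S ⊢ φ ⇒ φ
    ⇒-refl φ = mp (mp (axS φ (φ ⇒ φ) φ) (axK φ (φ ⇒ φ))) (axK φ φ)

    hyp₀ : ∀ {σ} → S σ → S ⊢ σ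
    hyp₀ {σ} x = subst (S ⊢_) (close-id σ) (hyp x)

    ⊢-ren : ∀ {n m} (ρ : Fin n → Fin m) {φ} → S ⊢ φ → S ⊢ ren ρ φ
    ⊢-ren ρ (hyp {σ = σ} x)   = subst (S ⊢_) (sym (ren-close ρ σ)) (hyp x)
    ⊢-ren ρ (axK φ ψ)         = axK _ _
    ⊢-ren ρ (axS φ ψ χ)       = axS _ _ _
    ⊢-ren ρ (axDN φ)          = axDN _
    ⊢-ren ρ (mp d e)          = mp (⊢-ren ρ d) (⊢-ren ρ e)
    ⊢-ren ρ (∀elim φ t)       =
      subst (λ z → S ⊢ ∀' (ren (ext ρ) φ) ⇒ z) (sym (ren-sub0 ρ t φ)) (∀elim _ (ρ t))
    ⊢-ren ρ (∀dist ψ φ)       =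
      subst (λ z → S ⊢ ∀' (z ⇒ ren (ext ρ) φ) ⇒ ren ρ ψ ⇒ ∀' (ren (ext ρ) φ))
        (sym (ren-wk ρ ψ)) (∀dist _ _)
    ⊢-ren ρ (gen d)           = gen (⊢-ren (ext ρ) d)
    ⊢-ren ρ (nonemp χ)        = subst (λ z → S ⊢ ∀' z ⇒ ren ρ χ) (sym (ren-wk ρ χ)) (nonemp _)
    ⊢-ren ρ (eqRefl t)        = eqRefl _
    ⊢-ren ρ (eqSubst φ t u)   =
      subst₂ (λ a b → S ⊢ (ρ t ≐ ρ u) ⇒ a ⇒ b)
        (sym (ren-sub0 ρ t φ)) (sym (ren-sub0 ρ u φ)) (eqSubst _ _ _)

  ⊢-cut : ∀ {S S' : Theory} → (∀ σ → S σ → S' ⊢ σ) → ∀ {n} {φ : Formula n} → S ⊢ φ → S' ⊢ φ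
  ⊢-cut f (hyp {σ = σ} x) = ⊢-ren (λ ()) (f σ x)
  ⊢-cut f (axK φ ψ)       = axK φ ψ
  ⊢-cut f (axS φ ψ χ)     = axS φ ψ χ
  ⊢-cut f (axDN φ)        = axDN φ
  ⊢-cut f (mp d e)        = mp (⊢-cut f d) (⊢-cut f e)
  ⊢-cut f (∀elim φ t)     = ∀elim φ t
  ⊢-cut f (∀dist ψ φ)     = ∀dist ψ φ
  ⊢-cut f (gen d)         = gen (⊢-cut f d)
  ⊢-cut f (nonemp χ)      = nonemp χ
  ⊢-cut f (eqRefl t)      = eqRefl t
  ⊢-cut f (eqSubst φ t u) = eqSubst φ t u

  ⊢-mono : ∀ {S S' : Theory} → S ⊆ S' → ∀ {n} {φ : Formula n} → S ⊢ φ → S' ⊢ φ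
  ⊢-mono f = ⊢-cut (λ σ x → hyp₀ (f σ x))

  infix 2 _∣_⊩_
  data _∣_⊩_ (S : Theory) {n : ℕ} (Γ : List (Formula n)) : Formula n → Set where
    ass  : ∀ {φ} → φ ∈ Γ → S ∣ Γ ⊩ φ
    lift : ∀ {φ} → S ⊢ φ → S ∣ Γ ⊩ φ
    ⇒I   : ∀ {φ ψ} → S ∣ φ ∷ Γ ⊩ ψ → S ∣ Γ ⊩ φ ⇒ ψ
    ⇒E   : ∀ {φ ψ} → S ∣ Γ ⊩ φ ⇒ ψ → S ∣ Γ ⊩ φ → S ∣ Γ ⊩ ψ
    ∀I   : ∀ {φ} → S ∣ map wk Γ ⊩ φ → S ∣ Γ ⊩ ∀' φ

  ⊩-weaken : ∀ {S n} {Γ Δ : List (Formula n)} {φ} → Γ ⊆ᴸ Δ → S ∣ Γ ⊩ φ → S ∣ Δ ⊩ φ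
  ⊩-weaken s (ass x)  = ass (s x)
  ⊩-weaken s (lift x) = lift x
  ⊩-weaken s (⇒I d)   = ⇒I (⊩-weaken (∷⁺ʳ _ s) d)
  ⊩-weaken s (⇒E d e) = ⇒E (⊩-weaken s d) (⊩-weaken s e)
  ⊩-weaken s (∀I d)   = ∀I (⊩-weaken (⊆ᴸ-map⁺ wk s) d)

  -- Natural deduction is read back by the deduction theorem, discharging Γ as Γ ⇛ φ.
  _⇛_ : ∀ {n} → List (Formula n) → Formula n → Formula n
  []      ⇛ ψ = ψ
  (φ ∷ Γ) ⇛ ψ = Γ ⇛ (φ ⇒ ψ)

  module _ {S : Theory} where

    private
      ⇒-map : ∀ {n} {A B : Formula n} (C : Formula n) → S ⊢ A ⇒ B → S ⊢ (C ⇒ A) ⇒ (C ⇒ B)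
      ⇒-map {A = A} {B} C d = mp (axS C A B) (mp (axK _ C) d)

      ⇛-map : ∀ {n} (Γ : List (Formula n)) {A B} → S ⊢ A ⇒ B → S ⊢ (Γ ⇛ A) ⇒ (Γ ⇛ B)
      ⇛-map []      d = d
      ⇛-map (γ ∷ Γ) d = ⇛-map Γ (⇒-map γ d)

      ⇛-pure : ∀ {n} (Γ : List (Formula n)) {A} → S ⊢ A → S ⊢ Γ ⇛ A
      ⇛-pure []      d = d
      ⇛-pure (γ ∷ Γ) d = ⇛-pure Γ (mp (axK _ γ) d)

      ⇛-ap : ∀ {n} (Γ : List (Formula n)) {A B} → S ⊢ Γ ⇛ (A ⇒ B) → S ⊢ Γ ⇛ A → S ⊢ Γ ⇛ B
      ⇛-ap []      d e = mp d e
      ⇛-ap (γ ∷ Γ) d e = ⇛-ap Γ (mp (⇛-map Γ (axS γ _ _)) d) e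

      ⇛-ass : ∀ {n} (Γ : List (Formula n)) {φ} → φ ∈ Γ → S ⊢ Γ ⇛ φ
      ⇛-ass (γ ∷ Γ) (here refl) = ⇛-pure Γ (⇒-refl γ)
      ⇛-ass (γ ∷ Γ) (there p)   = mp (⇛-map Γ (axK _ γ)) (⇛-ass Γ p)

      ⇛-gen : ∀ {n} (Γ : List (Formula n)) {φ} → S ⊢ map wk Γ ⇛ φ → S ⊢ Γ ⇛ ∀' φ
      ⇛-gen []      d = gen d
      ⇛-gen (γ ∷ Γ) d = mp (⇛-map Γ (∀dist γ _)) (⇛-gen Γ d)

    ⊩⇒⊢⇛ : ∀ {n} {Γ : List (Formula n)} {φ} → S ∣ Γ ⊩ φ → S ⊢ Γ ⇛ φ
    ⊩⇒⊢⇛ {Γ = Γ} (ass x)  = ⇛-ass Γ x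
    ⊩⇒⊢⇛ {Γ = Γ} (lift x) = ⇛-pure Γ x
    ⊩⇒⊢⇛         (⇒I d)   = ⊩⇒⊢⇛ d
    ⊩⇒⊢⇛ {Γ = Γ} (⇒E d e) = ⇛-ap Γ (⊩⇒⊢⇛ d) (⊩⇒⊢⇛ e)
    ⊩⇒⊢⇛ {Γ = Γ} (∀I d)   = ⇛-gen Γ (⊩⇒⊢⇛ d)

    ⊩⇒⊢ : ∀ {n} {φ : Formula n} → S ∣ [] ⊩ φ → S ⊢ φ
    ⊩⇒⊢ = ⊩⇒⊢⇛

  module Rules {S : Theory} where

    weaken₁ : ∀ {n} {Γ : List (Formula n)} {ψ φ} → S ∣ Γ ⊩ φ → S ∣ ψ ∷ Γ ⊩ φ
    weaken₁ = ⊩-weaken (xs⊆x∷xs _ _)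

    ⇒E⊢ : ∀ {n} {Γ : List (Formula n)} {A B} → S ⊢ A ⇒ B → S ∣ Γ ⊩ A → S ∣ Γ ⊩ B
    ⇒E⊢ h d = ⇒E (lift h) d

    ∀E : ∀ {n} {Γ : List (Formula n)} {φ} → S ∣ Γ ⊩ ∀' φ → (t : Fin n) → S ∣ Γ ⊩ sub0 t φ
    ∀E d t = ⇒E⊢ (∀elim _ t) d

    raa : ∀ {n} {Γ : List (Formula n)} {φ} → S ∣ ¬' φ ∷ Γ ⊩ ⊥' → S ∣ Γ ⊩ φ
    raa d = ⇒E⊢ (axDN _) (⇒I d)

    ⊥E : ∀ {n} {Γ : List (Formula n)} {φ} → S ∣ Γ ⊩ ⊥' → S ∣ Γ ⊩ φ
    ⊥E d = raa (weaken₁ d)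

    ⊤I : ∀ {n} {Γ : List (Formula n)} → S ∣ Γ ⊩ ⊤'
    ⊤I = ⇒I (ass (here refl))

    ∧I : ∀ {n} {Γ : List (Formula n)} {A B} → S ∣ Γ ⊩ A → S ∣ Γ ⊩ B → S ∣ Γ ⊩ A ∧' B
    ∧I a b = ⇒I (⇒E (⇒E (ass (here refl)) (weaken₁ a)) (weaken₁ b))

    ∧E₁ : ∀ {n} {Γ : List (Formula n)} {A B} → S ∣ Γ ⊩ A ∧' B → S ∣ Γ ⊩ A
    ∧E₁ d = raa (⇒E (weaken₁ d) (⇒I (⊥E (⇒E (ass (there (here refl))) (ass (here refl))))))

    ∧E₂ : ∀ {n} {Γ : List (Formula n)} {A B} → S ∣ Γ ⊩ A ∧' B → S ∣ Γ ⊩ B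
    ∧E₂ d = raa (⇒E (weaken₁ d) (⇒I (ass (there (here refl)))))

    ∃I : ∀ {n} {Γ : List (Formula n)} {φ} (t : Fin n) → S ∣ Γ ⊩ sub0 t φ → S ∣ Γ ⊩ ∃' φ
    ∃I t d = ⇒I (⇒E (∀E (ass (here refl)) t) (weaken₁ d))

    ∃I₀ : ∀ {n} {Γ : List (Formula (suc n))} {φ} → S ∣ Γ ⊩ φ → S ∣ Γ ⊩ wk (∃' φ)
    ∃I₀ {Γ = Γ} {φ} d =
      ∃I zero (subst (S ∣ Γ ⊩_) (sym (sub0-zero-ext-suc φ)) d)

    ∃E : ∀ {n} {Γ : List (Formula n)} {φ χ} →
         S ∣ Γ ⊩ ∃' φ → S ∣ φ ∷ map wk Γ ⊩ wk χ → S ∣ Γ ⊩ χ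
    ∃E dex d =
      raa (⇒E (weaken₁ dex) (∀I (⇒I (⇒E (ass (there (here refl)))
        (⊩-weaken (∷⁺ʳ _ (xs⊆x∷xs _ _)) d)))))

    byCases : ∀ {n} {Γ : List (Formula n)} {φ χ} →
              S ∣ φ ∷ Γ ⊩ χ → S ∣ ¬' φ ∷ Γ ⊩ χ → S ∣ Γ ⊩ χ
    byCases d₁ d₂ =
      raa (⇒E (ass (here refl)) (⇒E (weaken₁ (⇒I d₂))
        (⇒I (⇒E (ass (there (here refl))) (⊩-weaken (∷⁺ʳ _ (xs⊆x∷xs _ _)) d₁)))))

    ≐-sym : ∀ {n} {Γ : List (Formula n)} {t u} → S ∣ Γ ⊩ t ≐ u → S ∣ Γ ⊩ u ≐ t
    ≐-sym {t = t} {u} d = ⇒E (⇒E (lift (eqSubst (zero ≐ suc t) t u)) d) (lift (eqRefl t))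

    ≐-trans : ∀ {n} {Γ : List (Formula n)} {t u v} →
              S ∣ Γ ⊩ t ≐ u → S ∣ Γ ⊩ u ≐ v → S ∣ Γ ⊩ t ≐ v
    ≐-trans {t = t} {u} {v} d e = ⇒E (⇒E (lift (eqSubst (suc t ≐ zero) u v)) e) d

module Semantics (L : Set) where
  open FOL L
  open Syntax L

  _∷ₑ_ : ∀ {n} → ℕ → (Fin n → ℕ) → Fin (suc n) → ℕ
  (d ∷ₑ e) zero    = d
  (d ∷ₑ e) (suc i) = e i

  ε₀ : Fin 0 → ℕ
  ε₀ ()

  -- Structures have domain ℕ.  Atoms are read through ¬¬, so every formula is
  -- ¬¬-stable and the classical axiom axDN is sound without excluded middle.
  module Interpretation (I : L → ℕ → Set) where

    ⟦_⟧ : ∀ {n} → Formula n → (Fin n → ℕ) → Set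
    ⟦ rel r t ⟧ e = ¬ ¬ I r (e t)
    ⟦ t ≐ u ⟧   e = e t ≡ e u
    ⟦ ⊥' ⟧      e = ⊥
    ⟦ φ ⇒ ψ ⟧   e = ⟦ φ ⟧ e → ⟦ ψ ⟧ e
    ⟦ ∀' φ ⟧    e = (d : ℕ) → ⟦ φ ⟧ (d ∷ₑ e)

    Valid : Theory → Set
    Valid S = ∀ σ → S σ → ⟦ σ ⟧ ε₀

    ⟦⟧-stable : ∀ {n} (φ : Formula n) e → ¬ ¬ ⟦ φ ⟧ e → ⟦ φ ⟧ e
    ⟦⟧-stable (rel r t) e h = λ z → h (λ w → w z)
    ⟦⟧-stable (t ≐ u)   e h with e t ≟ e u
    ... | yes p = p
    ... | no q  = ⊥-elim (h q)
    ⟦⟧-stable ⊥'        e h = h (λ z → z)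
    ⟦⟧-stable (φ ⇒ ψ)   e h = λ x → ⟦⟧-stable ψ e (λ k → h (λ f → k (f x)))
    ⟦⟧-stable (∀' φ)    e h = λ d → ⟦⟧-stable φ (d ∷ₑ e) (λ k → h (λ f → k (f d)))

    ⟦∧⟧⁺ : ∀ {n} (A B : Formula n) {e} → ⟦ A ⟧ e → ⟦ B ⟧ e → ⟦ A ∧' B ⟧ e
    ⟦∧⟧⁺ A B a b = λ f → f a b

    ⟦⟧-cong : ∀ {n} (φ : Formula n) {e e'} → (∀ i → e i ≡ e' i) → ⟦ φ ⟧ e → ⟦ φ ⟧ e'
    ⟦⟧-cong (rel r t) q h = subst (λ z → ¬ ¬ I r z) (q t) h
    ⟦⟧-cong (t ≐ u)   q h = trans (sym (q t)) (trans h (q u))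
    ⟦⟧-cong ⊥'        q h = h
    ⟦⟧-cong (φ ⇒ ψ)   q h = λ x → ⟦⟧-cong ψ q (h (⟦⟧-cong φ (λ i → sym (q i)) x))
    ⟦⟧-cong (∀' φ)    q h = λ d → ⟦⟧-cong φ (λ { zero → refl ; (suc i) → q i }) (h d)

    ⟦ren⟧⁻ : ∀ {n m} (ρ : Fin n → Fin m) φ e → ⟦ ren ρ φ ⟧ e → ⟦ φ ⟧ (λ i → e (ρ i))
    ⟦ren⟧⁺ : ∀ {n m} (ρ : Fin n → Fin m) φ e → ⟦ φ ⟧ (λ i → e (ρ i)) → ⟦ ren ρ φ ⟧ e
    ⟦ren⟧⁻ ρ (rel r t) e h = h
    ⟦ren⟧⁻ ρ (t ≐ u)   e h = h
    ⟦ren⟧⁻ ρ ⊥'        e h = h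
    ⟦ren⟧⁻ ρ (φ ⇒ ψ)   e h = λ x → ⟦ren⟧⁻ ρ ψ e (h (⟦ren⟧⁺ ρ φ e x))
    ⟦ren⟧⁻ ρ (∀' φ)    e h = λ d →
      ⟦⟧-cong φ (λ { zero → refl ; (suc i) → refl }) (⟦ren⟧⁻ (ext ρ) φ (d ∷ₑ e) (h d))
    ⟦ren⟧⁺ ρ (rel r t) e h = h
    ⟦ren⟧⁺ ρ (t ≐ u)   e h = h
    ⟦ren⟧⁺ ρ ⊥'        e h = h
    ⟦ren⟧⁺ ρ (φ ⇒ ψ)   e h = λ x → ⟦ren⟧⁺ ρ ψ e (h (⟦ren⟧⁻ ρ φ e x))
    ⟦ren⟧⁺ ρ (∀' φ)    e h = λ d →
      ⟦ren⟧⁺ (ext ρ) φ (d ∷ₑ e) (⟦⟧-cong φ (λ { zero → refl ; (suc i) → refl }) (h d))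

    ⟦sub0⟧⁻ : ∀ {n} t (φ : Formula (suc n)) e → ⟦ sub0 t φ ⟧ e → ⟦ φ ⟧ (e t ∷ₑ e)
    ⟦sub0⟧⁻ t φ e h = ⟦⟧-cong φ (λ { zero → refl ; (suc i) → refl }) (⟦ren⟧⁻ _ φ e h)

    ⟦sub0⟧⁺ : ∀ {n} t (φ : Formula (suc n)) e → ⟦ φ ⟧ (e t ∷ₑ e) → ⟦ sub0 t φ ⟧ e
    ⟦sub0⟧⁺ t φ e h = ⟦ren⟧⁺ _ φ e (⟦⟧-cong φ (λ { zero → refl ; (suc i) → refl }) h)

    soundness : ∀ {S} → Valid S → ∀ {n} {φ : Formula n} → S ⊢ φ → ∀ e → ⟦ φ ⟧ e
    soundness M (hyp {σ = σ} x)   e = ⟦ren⟧⁺ (λ ()) σ e (⟦⟧-cong σ (λ ()) (M σ x))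
    soundness M (axK φ ψ)         e = λ x _ → x
    soundness M (axS φ ψ χ)       e = λ f g x → f x (g x)
    soundness M (axDN φ)          e = ⟦⟧-stable φ e
    soundness M (mp d d')         e = soundness M d e (soundness M d' e)
    soundness M (∀elim φ t)       e = λ h → ⟦sub0⟧⁺ t φ e (h (e t))
    soundness M (∀dist ψ φ)       e = λ h x d → h d (⟦ren⟧⁺ suc ψ (d ∷ₑ e) x)
    soundness M (gen d)           e = λ x → soundness M d (x ∷ₑ e)
    soundness M (nonemp χ)        e = λ h → ⟦ren⟧⁻ suc χ (0 ∷ₑ e) (h 0)
    soundness M (eqRefl t)        e = refl
    soundness M (eqSubst φ t u)   e = λ q h →
      ⟦sub0⟧⁺ u φ e (subst (λ z → ⟦ φ ⟧ (z ∷ₑ e)) q (⟦sub0⟧⁻ t φ e h))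

  module Agreement (I I' : L → ℕ → Set) (G : L → Set)
                   (agree : ∀ r → G r → ∀ x → (I r x → I' r x) × (I' r x → I r x)) where
    private
      module M  = Interpretation I
      module M' = Interpretation I'

    agree⁺ : ∀ {n} (φ : Formula n) → AllSymbols G φ → ∀ e → M.⟦ φ ⟧ e → M'.⟦ φ ⟧ e
    agree⁻ : ∀ {n} (φ : Formula n) → AllSymbols G φ → ∀ e → M'.⟦ φ ⟧ e → M.⟦ φ ⟧ e
    agree⁺ (rel r t) g e h = λ k → h (λ z → k (proj₁ (agree r g (e t)) z))
    agree⁺ (t ≐ u)   g e h = h
    agree⁺ ⊥'        g e h = h
    agree⁺ (φ ⇒ ψ)   (gφ , gψ) e h = λ x → agree⁺ ψ gψ e (h (agree⁻ φ gφ e x))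
    agree⁺ (∀' φ)    g e h = λ d → agree⁺ φ g (d ∷ₑ e) (h d)
    agree⁻ (rel r t) g e h = λ k → h (λ z → k (proj₂ (agree r g (e t)) z))
    agree⁻ (t ≐ u)   g e h = h
    agree⁻ ⊥'        g e h = h
    agree⁻ (φ ⇒ ψ)   (gφ , gψ) e h = λ x → agree⁻ ψ gψ e (h (agree⁺ φ gφ e x))
    agree⁻ (∀' φ)    g e h = λ d → agree⁻ φ g (d ∷ₑ e) (h d)

-- atLeastʸ A k r lives over k chosen elements (the variables inject₁ j) and a parameter y
-- (the variable fromℕ k); it says that r further elements x, pairwise distinct and distinct
-- from the chosen ones, satisfy A(x, y).
module Counting (L : Set) where
  open FOL L
  open Syntax L
  open Derivations L

  y-last : ∀ k → Fin 2 → Fin (suc (suc k))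
  y-last k zero       = zero
  y-last k (suc zero) = fromℕ (suc k)

  atLeastʸ : Formula 2 → (k r : ℕ) → Formula (suc k)
  oneMoreʸ : Formula 2 → (k r : ℕ) → Formula (suc (suc k))
  atLeastʸ A k zero    = ⊤'
  atLeastʸ A k (suc r) = ∃' (oneMoreʸ A k r)
  oneMoreʸ A k r = ren inject₁ (neqAll k) ∧' (ren (y-last k) A ∧' atLeastʸ A (suc k) r)

  atLeastGo-ren-inject₁ : ∀ (φ : Formula 1) k r →
                          ren inject₁ (atLeastGo φ k r) ≡ atLeastʸ (ren inject₁ φ) k r
  atLeastGo-ren-inject₁ φ k zero    = refl
  atLeastGo-ren-inject₁ φ k (suc r) = cong₂ (λ a b → ∃' (a ∧' b))
    (ren-cong (λ { zero → refl ; (suc i) → refl }) (neqAll k))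
    (cong₂ _∧'_
      (trans (ren-∘ (ext inject₁) (λ _ → zero) φ)
        (trans (ren-cong (λ { zero → refl }) φ) (sym (ren-∘ (y-last k) inject₁ φ))))
      (trans (ren-cong (λ { zero → refl ; (suc i) → refl }) (atLeastGo φ (suc k) r))
        (atLeastGo-ren-inject₁ φ (suc k) r)))

  close-atLeast : ∀ r (φ : Formula 1) → close {1} (atLeast r φ) ≡ atLeastʸ (ren inject₁ φ) 0 r
  close-atLeast r φ = trans (ren-cong (λ ()) (atLeastGo φ 0 r)) (atLeastGo-ren-inject₁ φ 0 r)

  avoidingʸ : Formula 2 → Formula 2
  avoidingʸ A = A ∧' ¬' (zero ≐ suc zero)

  Embeddingʸ : ∀ k k' → (Fin (suc k) → Fin (suc k')) → Set
  Embeddingʸ k k' δ =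
    (δ (fromℕ k) ≡ fromℕ k') × (∀ (j : Fin k) → ∃ λ j' → δ (inject₁ j) ≡ inject₁ j')

  Embeddingʸ-ext : ∀ {k k' δ} → Embeddingʸ k k' δ → Embeddingʸ (suc k) (suc k') (ext δ)
  Embeddingʸ-ext (δy , δc) = cong suc δy , λ
    { zero    → zero , refl
    ; (suc j) → suc (proj₁ (δc j)) , cong suc (proj₂ (δc j)) }

  module _ {S : Theory} where
    open Rules {S}

    neqAll-elim : ∀ {n k} {Γ : List (Formula n)} (ρ : Fin (suc k) → Fin n) →
                  S ∣ Γ ⊩ ren ρ (neqAll k) → ∀ j → S ∣ Γ ⊩ ¬' (ρ zero ≐ ρ (suc j))
    neqAll-elim {k = k} ρ d j = go (allFin k) d (∈-allFin j)
      where
      go : ∀ l → S ∣ _ ⊩ ren ρ (neqList l) → ∀ {j} → j ∈ l → S ∣ _ ⊩ ¬' (ρ zero ≐ ρ (suc j))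
      go (j ∷ l) d (here refl) = ∧E₁ d
      go (j ∷ l) d (there p)   = go l (∧E₂ d) p

    neqAll-intro : ∀ {n k} {Γ : List (Formula n)} (ρ : Fin (suc k) → Fin n) →
                   (∀ j → S ∣ Γ ⊩ ¬' (ρ zero ≐ ρ (suc j))) → S ∣ Γ ⊩ ren ρ (neqAll k)
    neqAll-intro {k = k} ρ f = go (allFin k)
      where
      go : ∀ l → S ∣ _ ⊩ ren ρ (neqList l)
      go []      = ⊤I
      go (j ∷ l) = ∧I (f j) (go l)

    atLeastʸ-mono : ∀ {A A'} → S ⊢ A ⇒ A' → ∀ k r {Γ : List (Formula (suc k))} →
                    S ∣ Γ ⊩ atLeastʸ A k r → S ∣ Γ ⊩ atLeastʸ A' k r
    atLeastʸ-mono h k zero    d = d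
    atLeastʸ-mono {A} h k (suc r) {Γ} d = ∃E d (∃I₀ (∧I (∧E₁ H)
      (∧I (⇒E⊢ (⊢-ren (y-last k) h) (∧E₁ (∧E₂ H))) (atLeastʸ-mono h (suc k) r (∧E₂ (∧E₂ H))))))
      where
      H : S ∣ oneMoreʸ A k r ∷ map wk Γ ⊩ oneMoreʸ A k r
      H = ass (here refl)

    -- If y is already among the chosen elements, no witness can be equal to y.
    atLeastʸ-avoid-chosen :
      ∀ A r k k' (δ : Fin (suc k) → Fin (suc k')) → Embeddingʸ k k' δ →
      (p : Fin k') → ∀ {Γ} → (inject₁ p ≐ fromℕ k') ∈ Γ →
      S ∣ Γ ⊩ atLeastʸ A k' r → S ∣ Γ ⊩ ren δ (atLeastʸ (avoidingʸ A) k r)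
    atLeastʸ-avoid-chosen A zero    k k' δ emb p mem d = ⊤I
    atLeastʸ-avoid-chosen A (suc r) k k' δ emb@(δy , δc) p {Γ} mem d =
      ∃E d (∃I₀ (∧I distinct (∧I witness rest)))
      where
      Γ' : List (Formula (suc (suc k')))
      Γ' = oneMoreʸ A k' r ∷ map wk Γ
      H : S ∣ Γ' ⊩ oneMoreʸ A k' r
      H = ass (here refl)
      x≢chosen : ∀ j → S ∣ Γ' ⊩ ¬' (zero ≐ suc (inject₁ j))
      x≢chosen = neqAll-elim inject₁ (∧E₁ H)
      x≢y : S ∣ Γ' ⊩ ¬' (zero ≐ fromℕ (suc k'))
      x≢y = ⇒I (⇒E (weaken₁ (x≢chosen p))
        (≐-trans (ass (here refl)) (≐-sym (ass (there (there (∈-map⁺ wk mem)))))))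
      distinct : S ∣ Γ' ⊩ ren (ext δ) (ren inject₁ (neqAll k))
      distinct = subst (S ∣ Γ' ⊩_) (sym (ren-∘ (ext δ) inject₁ (neqAll k)))
        (neqAll-intro (λ i → ext δ (inject₁ i)) λ j →
          subst (λ z → S ∣ Γ' ⊩ ¬' (zero ≐ suc z)) (sym (proj₂ (δc j))) (x≢chosen (proj₁ (δc j))))
      witness : S ∣ Γ' ⊩ ren (ext δ) (ren (y-last k) (avoidingʸ A))
      witness = subst (S ∣ Γ' ⊩_)
        (sym (trans (ren-∘ (ext δ) (y-last k) (avoidingʸ A))
          (ren-cong (λ { zero → refl ; (suc zero) → cong suc δy }) (avoidingʸ A))))
        (∧I (∧E₁ (∧E₂ H)) x≢y)
      rest : S ∣ Γ' ⊩ ren (ext δ) (atLeastʸ (avoidingʸ A) (suc k) r)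
      rest = atLeastʸ-avoid-chosen A r (suc k) (suc k') (ext δ) (Embeddingʸ-ext emb) (suc p)
        (there (∈-map⁺ wk mem)) (∧E₂ (∧E₂ H))

    -- Of r + 1 distinct witnesses at most one is y itself.
    atLeastʸ-avoid : ∀ A r k {Γ : List (Formula (suc k))} →
                     S ∣ Γ ⊩ atLeastʸ A k (suc r) → S ∣ Γ ⊩ atLeastʸ (avoidingʸ A) k r
    atLeastʸ-avoid A zero    k d = ⊤I
    atLeastʸ-avoid A (suc r) k {Γ} d = ∃E d (byCases x≡y x≢y)
      where
      Γ' : List (Formula (suc (suc k)))
      Γ' = oneMoreʸ A k (suc r) ∷ map wk Γ
      H : S ∣ Γ' ⊩ oneMoreʸ A k (suc r)
      H = ass (here refl)
      x≡y : S ∣ (zero ≐ fromℕ (suc k)) ∷ Γ' ⊩ wk (atLeastʸ (avoidingʸ A) k (suc r))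
      x≡y = atLeastʸ-avoid-chosen A (suc r) k (suc k) suc (refl , λ j → suc j , refl) zero
        (here refl) (weaken₁ (∧E₂ (∧E₂ H)))
      x≢y : S ∣ ¬' (zero ≐ fromℕ (suc k)) ∷ Γ' ⊩ wk (atLeastʸ (avoidingʸ A) k (suc r))
      x≢y = ∃I₀ (∧I (weaken₁ (∧E₁ H)) (∧I (∧I (weaken₁ (∧E₁ (∧E₂ H))) (ass (here refl)))
        (weaken₁ (atLeastʸ-avoid A r (suc k) (∧E₂ (∧E₂ H))))))

module Avoidance (L : Set) {D : L → Set} (D? : ∀ r → Dec (D r)) where
  open FOL L
  open Syntax L
  open Derivations L
  open Counting L

  avoidAtom : ∀ {n} (r : L) → Dec (D r) → Fin n → Fin n → Formula n
  avoidAtom r (yes _) t y = rel r t ∧' ¬' (t ≐ y)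
  avoidAtom r (no _)  t y = rel r t

  avoid : ∀ {n} → Fin n → Formula n → Formula n
  avoid y (rel r t) = avoidAtom r (D? r) t y
  avoid y (t ≐ u)   = t ≐ u
  avoid y ⊥'        = ⊥'
  avoid y (φ ⇒ ψ)   = avoid y φ ⇒ avoid y ψ
  avoid y (∀' φ)    = ∀' (avoid (suc y) φ)

  avoid-ren : ∀ {n m} (ρ : Fin n → Fin m) y φ → avoid (ρ y) (ren ρ φ) ≡ ren ρ (avoid y φ)
  avoid-ren ρ y (rel r t) with D? r
  ... | yes _ = refl
  ... | no _  = refl
  avoid-ren ρ y (t ≐ u)   = refl
  avoid-ren ρ y ⊥'        = refl
  avoid-ren ρ y (φ ⇒ ψ)   = cong₂ _⇒_ (avoid-ren ρ y φ) (avoid-ren ρ y ψ)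
  avoid-ren ρ y (∀' φ)    = cong ∀' (avoid-ren (ext ρ) (suc y) φ)

  avoid-sub0 : ∀ {n} (y t : Fin n) φ → avoid y (sub0 t φ) ≡ sub0 t (avoid (suc y) φ)
  avoid-sub0 y t φ = trans (cong (avoid y) (sub0-ren t φ))
    (trans (avoid-ren (sub0-map t) (suc y) φ) (sym (sub0-ren t _)))

  avoid-id : ∀ {n} (y : Fin n) φ → AllSymbols (λ r → ¬ D r) φ → avoid y φ ≡ φ
  avoid-id y (rel r t) g with D? r
  ... | yes d = ⊥-elim (g d)
  ... | no _  = refl
  avoid-id y (t ≐ u)   g         = refl
  avoid-id y ⊥'        g         = refl
  avoid-id y (φ ⇒ ψ)   (gφ , gψ) = cong₂ _⇒_ (avoid-id y φ gφ) (avoid-id y ψ gψ)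
  avoid-id y (∀' φ)    g         = cong ∀' (avoid-id (suc y) φ g)

  avoid-atLeastʸ : ∀ A k r → avoid (fromℕ k) (atLeastʸ A k r) ≡ atLeastʸ (avoid (suc zero) A) k r
  avoid-atLeastʸ A k zero    = refl
  avoid-atLeastʸ A k (suc r) = cong₂ (λ a b → ∃' (a ∧' b))
    (avoid-id _ (ren inject₁ (neqAll k)) (AllSymbols-ren inject₁ (neqAll k) (neqAll-AllSymbols _ k)))
    (cong₂ _∧'_ (avoid-ren (y-last k) (suc zero) A) (avoid-atLeastʸ A (suc k) r))

  AvoidClosed : Theory → Set
  AvoidClosed S = ∀ σ → S σ → S ⊢ avoid zero (close {1} σ)

  ⊢-avoid : ∀ {S} → AvoidClosed S → ∀ {n} {φ : Formula n} → S ⊢ φ → ∀ y → S ⊢ avoid y φ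
  ⊢-avoid {S} h (hyp {σ = σ} x)   y =
    subst (S ⊢_) (trans (sym (avoid-ren (λ _ → y) zero (close σ))) (cong (avoid y) (ren-close _ σ)))
      (⊢-ren (λ _ → y) (h σ x))
  ⊢-avoid     h (axK φ ψ)         y = axK _ _
  ⊢-avoid     h (axS φ ψ χ)       y = axS _ _ _
  ⊢-avoid     h (axDN φ)          y = axDN _
  ⊢-avoid     h (mp d e)          y = mp (⊢-avoid h d y) (⊢-avoid h e y)
  ⊢-avoid {S} h (∀elim φ t)       y =
    subst (λ z → S ⊢ ∀' (avoid (suc y) φ) ⇒ z) (sym (avoid-sub0 y t φ)) (∀elim _ t)
  ⊢-avoid {S} h (∀dist ψ φ)       y =
    subst (λ z → S ⊢ ∀' (z ⇒ avoid (suc y) φ) ⇒ avoid y ψ ⇒ ∀' (avoid (suc y) φ))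
      (sym (avoid-ren suc y ψ)) (∀dist _ _)
  ⊢-avoid     h (gen d)           y = gen (⊢-avoid h d (suc y))
  ⊢-avoid {S} h (nonemp χ)        y =
    subst (λ z → S ⊢ ∀' z ⇒ avoid y χ) (sym (avoid-ren suc y χ)) (nonemp _)
  ⊢-avoid     h (eqRefl t)        y = eqRefl t
  ⊢-avoid {S} h (eqSubst φ t u)   y =
    subst₂ (λ a b → S ⊢ (t ≐ u) ⇒ a ⇒ b) (sym (avoid-sub0 y t φ)) (sym (avoid-sub0 y u φ))
      (eqSubst _ _ _)

  module _ {S : Theory} where
    open Rules {S}

    avoid-atom-intro : ∀ {n} r (t y : Fin n) → S ⊢ (rel r t ∧' ¬' (t ≐ y)) ⇒ avoid y (rel r t)
    avoid-atom-intro r t y with D? r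
    ... | yes _ = ⇒-refl _
    ... | no _  = ⊩⇒⊢ (⇒I (∧E₁ (ass (here refl))))

    avoid-atom-self : ∀ {n} r → D r → (t : Fin n) → S ⊢ avoid t (rel r t) ⇒ ¬' (t ≐ t)
    avoid-atom-self r d t with D? r
    ... | yes _ = ⊩⇒⊢ (⇒I (∧E₂ (ass (here refl))))
    ... | no ¬d = ⊥-elim (¬d d)

    -- Relativize ∀x (ψ x → R x) to x ≠ y and take y := x: then ψ x forces x ≠ x.
    ¬∃-by-avoidance : AvoidClosed S → ∀ ψ → AllSymbols (λ r → ¬ D r) ψ → ∀ r → D r →
                      S ⊢ ∀' (ψ ⇒ rel r zero) → S ⊢ ¬' (∃' ψ)
    ¬∃-by-avoidance closed ψ noD r d ψ⇒R =
      ⊩⇒⊢ (⇒I (⇒E (ass (here refl)) (lift (gen ¬ψ))))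
      where
      ψ₁ : Formula 2
      ψ₁ = ren (ext (λ ())) ψ
      avoided : S ⊢ ∀' (avoid (suc zero) ψ₁ ⇒ avoid (suc zero) (rel r zero))
      avoided = ⊢-avoid closed (⊢-ren {m = 1} (λ ()) ψ⇒R) zero
      ψ₁-back : sub0 zero (avoid (suc zero) ψ₁) ≡ ψ
      ψ₁-back = trans (cong (sub0 zero) (avoid-id (suc zero) ψ₁ (AllSymbols-ren (ext (λ ())) ψ noD)))
        (trans (sub0-ren zero ψ₁)
          (trans (ren-∘ (sub0-map zero) (ext (λ ())) ψ) (ren-id (λ { zero → refl }) ψ)))
      ψ⇒avoided : S ⊢ ψ ⇒ avoid zero (rel r zero)
      ψ⇒avoided = subst₂ (λ a b → S ⊢ a ⇒ b) ψ₁-back (sym (avoid-sub0 zero zero (rel r zero)))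
        (mp (∀elim _ zero) avoided)
      ¬ψ : S ⊢ ¬' ψ
      ¬ψ = ⊩⇒⊢ (⇒I (⇒E (⇒E⊢ (avoid-atom-self r d zero) (⇒E⊢ ψ⇒avoided (ass (here refl))))
        (lift (eqRefl zero))))

<o-trans : ∀ {a b c} → a <o b → b <o c → a <o c
<o-trans (lt₁ p) (lt₁ q) = lt₁ (<-trans p q)
<o-trans (lt₁ p) (lt₂ q) = lt₁ p
<o-trans (lt₂ p) (lt₁ q) = lt₁ q
<o-trans (lt₂ p) (lt₂ q) = lt₂ (<-trans p q)

≤o-refl : ∀ {a} → a ≤o a
≤o-refl = inj₂ refl

≤o-trans : ∀ {a b c} → a ≤o b → b ≤o c → a ≤o c
≤o-trans (inj₁ p)    (inj₁ q)    = inj₁ (<o-trans p q)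
≤o-trans (inj₁ p)    (inj₂ refl) = inj₁ p
≤o-trans (inj₂ refl) q           = q

<-≤o-trans : ∀ {a b c} → a <o b → b ≤o c → a <o c
<-≤o-trans p (inj₁ q)    = <o-trans p q
<-≤o-trans p (inj₂ refl) = p

≤-<o-trans : ∀ {a b c} → a ≤o b → b <o c → a <o c
≤-<o-trans (inj₁ p)    q = <o-trans p q
≤-<o-trans (inj₂ refl) q = q

0≤o : ∀ a → (0 , 0) ≤o a
0≤o (zero , zero)  = inj₂ refl
0≤o (zero , suc n) = inj₁ (lt₂ (s≤s z≤n))
0≤o (suc m , n)    = inj₁ (lt₁ (s≤s z≤n))

≤o⇒proj₁≤ : ∀ {a b} → a ≤o b → proj₁ a ≤ proj₁ b
≤o⇒proj₁≤ (inj₁ (lt₁ p)) = <⇒≤ p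
≤o⇒proj₁≤ (inj₁ (lt₂ p)) = ≤-refl
≤o⇒proj₁≤ (inj₂ refl)    = ≤-refl

sucO : Ord → Ord
sucO (m , n) = (m , suc n)

<o-sucO : ∀ a → a <o sucO a
<o-sucO (m , n) = lt₂ (n<1+n n)

<⇒sucO≤ : ∀ {a b} → a <o b → sucO a ≤o b
<⇒sucO≤         (lt₁ p) = inj₁ (lt₁ p)
<⇒sucO≤ {m , n} (lt₂ {n' = n'} p) with suc n ≟ n'
... | yes refl = inj₂ refl
... | no q     = inj₁ (lt₂ (≤∧≢⇒< p q))

<sucO⇒≤o : ∀ {a b} → a <o sucO b → a ≤o b
<sucO⇒≤o                 (lt₁ p) = inj₁ (lt₁ p)
<sucO⇒≤o {_ , n} {_ , n'} (lt₂ p) with n ≟ n'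
... | yes refl = inj₂ refl
... | no q     = inj₁ (lt₂ (≤∧≢⇒< (≤-pred p) q))

<o-wellFounded : WellFounded _<o_
<o-wellFounded = Subrelation.wellFounded lex (×-wellFounded <-wellFounded <-wellFounded)
  where
  lex : ∀ {a b} → a <o b → (proj₁ a < proj₁ b) ⊎ (proj₁ a ≡ proj₁ b × proj₂ a < proj₂ b)
  lex (lt₁ p) = inj₁ p
  lex (lt₂ p) = inj₂ (refl , p)

sucO-≤-cancel : ∀ {a b} → sucO a ≤o sucO b → a ≤o b
sucO-≤-cancel {a} q = <sucO⇒≤o (<-≤o-trans (<o-sucO a) q)

∈⇒≤sum : ∀ {x xs} → x ∈ xs → x ≤ sum xs
∈⇒≤sum {xs = y ∷ xs} (here refl) = m≤m+n y (sum xs)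
∈⇒≤sum {xs = y ∷ xs} (there p)   = ≤-trans (∈⇒≤sum p) (m≤n+m (sum xs) y)

seq-mono : ∀ F m {i j} → i ≤ j → seq F m i ≤o seq F m j
seq-mono F m {i} {j} p with i ≟ j
... | yes refl = inj₂ refl
... | no q     = inj₁ (strict F m i j (≤∧≢⇒< p q))

-- The subtree of τ_α above s is τ_(rk α s); off the tree rk α s is junk.
module Rank (F : FundSeq) where

  childRank : Ord → ℕ → Ord
  childRank (zero , zero)  k = (0 , 0)
  childRank (m , suc n)    k = (m , n)
  childRank (suc m , zero) k = seq F m k

  rk : Ord → List ℕ → Ord
  rk α []      = α
  rk α (i ∷ s) = rk (childRank α i) s

  positive : Ord → Bool
  positive (zero , zero)  = false
  positive (m , suc n)    = true
  positive (suc m , zero) = true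

  rk-snoc : ∀ α t k → rk α (t ++ [ k ]) ≡ childRank (rk α t) k
  rk-snoc α []      k = refl
  rk-snoc α (i ∷ t) k = rk-snoc (childRank α i) t k

  inTau-∷ : ∀ α i s → T (positive α) → inTau F α (i ∷ s) ≡ inTau F (childRank α i) s
  inTau-∷ (zero , suc n)  i s _ = refl
  inTau-∷ (suc m , suc n) i s _ = refl
  inTau-∷ (suc m , zero)  i s _ = refl

  inTau-∷⇒positive : ∀ α i s → T (inTau F α (i ∷ s)) → T (positive α)
  inTau-∷⇒positive (zero , suc n)  i s _ = tt
  inTau-∷⇒positive (suc m , suc n) i s _ = tt
  inTau-∷⇒positive (suc m , zero)  i s _ = tt

  inTau-snoc : ∀ α t k → inTau F α (t ++ [ k ]) ≡ (inTau F α t ∧ positive (rk α t))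
  inTau-snoc (zero , zero)   []      k = refl
  inTau-snoc (zero , suc n)  []      k = refl
  inTau-snoc (suc m , suc n) []      k = refl
  inTau-snoc (suc m , zero)  []      k = refl
  inTau-snoc (zero , zero)   (i ∷ t) k = refl
  inTau-snoc (zero , suc n)  (i ∷ t) k = inTau-snoc (zero , n) t k
  inTau-snoc (suc m , suc n) (i ∷ t) k = inTau-snoc (suc m , n) t k
  inTau-snoc (suc m , zero)  (i ∷ t) k = inTau-snoc (seq F m i) t k

  inTau-snoc⁻ : ∀ α t k → T (inTau F α (t ++ [ k ])) → T (inTau F α t) × T (positive (rk α t))
  inTau-snoc⁻ α t k h = Equivalence.to T-∧ (subst T (inTau-snoc α t k) h)

  inTau-snoc⁺ : ∀ α t k → T (inTau F α t) → T (positive (rk α t)) → T (inTau F α (t ++ [ k ]))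
  inTau-snoc⁺ α t k h p = subst T (sym (inTau-snoc α t k)) (Equivalence.from T-∧ (h , p))

  childRank-< : ∀ α k → T (positive α) → childRank α k <o α
  childRank-< (zero , suc n)  k _ = lt₂ (n<1+n n)
  childRank-< (suc m , suc n) k _ = lt₂ (n<1+n n)
  childRank-< (suc m , zero)  k _ = bounded F m k

  childRank-≤ : ∀ α k → childRank α k ≤o α
  childRank-≤ (zero , zero)   k = ≤o-refl
  childRank-≤ (zero , suc n)  k = inj₁ (childRank-< (zero , suc n) k tt)
  childRank-≤ (suc m , suc n) k = inj₁ (childRank-< (suc m , suc n) k tt)
  childRank-≤ (suc m , zero)  k = inj₁ (childRank-< (suc m , zero) k tt)

  rk-≤ : ∀ α t → rk α t ≤o α
  rk-≤ α []      = ≤o-refl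
  rk-≤ α (i ∷ t) = ≤o-trans (rk-≤ (childRank α i) t) (childRank-≤ α i)

  rk-< : ∀ α j s → T (inTau F α (j ∷ s)) → rk α (j ∷ s) <o α
  rk-< α j s h = ≤-<o-trans (rk-≤ (childRank α j) s) (childRank-< α j (inTau-∷⇒positive α j s h))

  <o⇒positive : ∀ {β α} → β <o α → T (positive α)
  <o⇒positive {α = zero , suc n}  _ = tt
  <o⇒positive {α = suc m , suc n} _ = tt
  <o⇒positive {α = suc m , zero}  _ = tt
  <o⇒positive {α = zero , zero}   (lt₁ ())
  <o⇒positive {α = zero , zero}   (lt₂ ())

  childRank-cofinal : ∀ {β α} → β <o α → ∃ λ i → β ≤o childRank α i
  childRank-cofinal {α = zero , zero}   (lt₁ ())
  childRank-cofinal {α = zero , zero}   (lt₂ ())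
  childRank-cofinal {α = zero , suc n}  p = 0 , <sucO⇒≤o p
  childRank-cofinal {α = suc m , suc n} p = 0 , <sucO⇒≤o p
  childRank-cofinal {α = suc m , zero}  p with cofinal F m _ p
  ... | i , q = i , inj₁ q

  threshold : Ord → ℕ → ℕ
  threshold (m , n) m' with m <? suc m'
  ... | yes p = proj₁ (cofinal F m' (m , n) (lt₁ p))
  ... | no _  = 0

  threshold-< : ∀ {a m' N} → a <o (suc m' , 0) → threshold a m' ≤ N → a <o seq F m' N
  threshold-< {m , n} {m'} (lt₁ p) q with m <? suc m'
  ... | yes p' = <-≤o-trans (proj₂ (cofinal F m' (m , n) (lt₁ p'))) (seq-mono F m' q)
  ... | no ¬p  = ⊥-elim (¬p p)

  cofinalityBound : Ord → ℕ → ℕ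
  cofinalityBound a M = sum (applyUpTo (threshold a) M)

  childRank-large : ∀ {a δ M N} → sucO a ≤o δ → proj₁ δ ≤ M → cofinalityBound a M ≤ N →
                    a ≤o childRank δ N
  childRank-large {_ , _} {zero , zero}    (inj₁ (lt₁ ())) _ _
  childRank-large {_ , _} {zero , zero}    (inj₁ (lt₂ ())) _ _
  childRank-large {_ , _} {zero , suc n}   q               _ _ = sucO-≤-cancel q
  childRank-large {_ , _} {suc m , suc n}  q               _ _ = sucO-≤-cancel q
  childRank-large {a} {suc m , zero} q δ≤M b≤N = inj₁ (threshold-< (<-≤o-trans (<o-sucO a) q)
    (≤-trans (∈⇒≤sum (∈-applyUpTo⁺ (threshold a) δ≤M)) b≤N))

  rk-snoc-large : ∀ α {a} t N → sucO a ≤o rk α t → cofinalityBound a (proj₁ α) ≤ N →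
                  a ≤o rk α (t ++ [ N ])
  rk-snoc-large α {a} t N q b≤N = subst (a ≤o_) (sym (rk-snoc α t N))
    (childRank-large q (≤o⇒proj₁≤ (rk-≤ α t)) b≤N)

  NodeOfRank : Ord → Ord → Set
  NodeOfRank α β = Σ ℕ λ j → Σ (List ℕ) λ s → T (inTau F α (j ∷ s)) × (rk α (j ∷ s) ≡ β)

  nodeOfRank : ∀ α → Acc _<o_ α → ∀ β → β <o α → NodeOfRank α β
  nodeOfRank α (acc rs) β p with childRank-cofinal p
  ... | i , inj₂ refl = i , [] , subst T (sym (inTau-∷ α i [] (<o⇒positive p))) tt , refl
  ... | i , inj₁ q with nodeOfRank (childRank α i) (rs (childRank-< α i (<o⇒positive p))) β q
  ... | j , s , h , e = i , j ∷ s , subst T (sym (inTau-∷ α i (j ∷ s) (<o⇒positive p))) h , e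

module Iteration (F : FundSeq) (α : Ord) where
  open TheoryT F α
  open Derivations (Sym F α)
  open Rank F

  brk⊆lev-suc : ∀ m n → brk (lev m n) ⊆ lev m (suc n)
  brk⊆lev-suc zero    n σ x = x
  brk⊆lev-suc (suc m) n σ x = x

  lev-suc⊆brk : ∀ m n → lev m (suc n) ⊆ brk (lev m n)
  lev-suc⊆brk zero    n σ x = x
  lev-suc⊆brk (suc m) n σ x = x

  lev⊆lev-suc : ∀ m n → lev m n ⊆ lev m (suc n)
  lev⊆lev-suc m n σ x = brk⊆lev-suc m n σ (hyp₀ (inj₁ x))

  lev⊆below : ∀ m n → lev m n ⊆ below m
  lev⊆below zero    n σ x = n , x
  lev⊆below (suc m) n σ x = inj₂ (n , x)

  below⇒lev : ∀ m σ → below m σ → ∃ λ k → lev m k σ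
  below⇒lev zero    σ (n , x)        = n , x
  below⇒lev (suc m) σ (inj₁ x)       = 0 , x
  below⇒lev (suc m) σ (inj₂ (n , x)) = n , x

  lev-mono : ∀ m {n n'} → n ≤ n' → lev m n ⊆ lev m n'
  lev-mono m p = go (≤⇒≤′ p)
    where
    go : ∀ {n n'} → n ≤′ n' → lev m n ⊆ lev m n'
    go ≤′-refl     σ x = x
    go (≤′-step p) σ x = lev⊆lev-suc m _ σ (go p σ x)

  lev⊆lev-limit : ∀ {m m'} n → m < m' → lev m n ⊆ lev m' 0
  lev⊆lev-limit {m} n p = go (≤⇒≤′ p)
    where
    go : ∀ {m'} → suc m ≤′ m' → lev m n ⊆ lev m' 0
    go ≤′-refl     = lev⊆below m n
    go (≤′-step p) σ x = lev⊆below _ 0 σ (go p σ x)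

  Iter-mono : ∀ {γ δ} → γ ≤o δ → Iter γ ⊆ Iter δ
  Iter-mono                     (inj₂ refl)    σ x = x
  Iter-mono {m , n}             (inj₁ (lt₂ p)) = lev-mono m (<⇒≤ p)
  Iter-mono {m , n} {m' , n'}   (inj₁ (lt₁ p)) σ x = lev-mono m' z≤n σ (lev⊆lev-limit n p σ x)

  TAx⊆Iter : ∀ γ → TAx ⊆ Iter γ
  TAx⊆Iter γ σ x = Iter-mono (0≤o γ) σ (hyp₀ x)

  -- A derivation uses finitely many hypotheses, all found at one level below the limit.
  below-⊢⇒lev-⊢ : ∀ m {n} {φ : Formula n} → below m ⊢ φ → ∃ λ k → lev m k ⊢ φ
  below-⊢⇒lev-⊢ m (hyp {σ = σ} x) with below⇒lev m σ x
  ... | k , y = k , hyp y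
  below-⊢⇒lev-⊢ m (axK φ ψ)       = 0 , axK φ ψ
  below-⊢⇒lev-⊢ m (axS φ ψ χ)     = 0 , axS φ ψ χ
  below-⊢⇒lev-⊢ m (axDN φ)        = 0 , axDN φ
  below-⊢⇒lev-⊢ m (mp d e) with below-⊢⇒lev-⊢ m d | below-⊢⇒lev-⊢ m e
  ... | k₁ , d₁ | k₂ , d₂ =
    k₁ + k₂ , mp (⊢-mono (lev-mono m (m≤m+n k₁ k₂)) d₁) (⊢-mono (lev-mono m (m≤n+m k₂ k₁)) d₂)
  below-⊢⇒lev-⊢ m (∀elim φ t)     = 0 , ∀elim φ t
  below-⊢⇒lev-⊢ m (∀dist ψ φ)     = 0 , ∀dist ψ φ
  below-⊢⇒lev-⊢ m (gen d) with below-⊢⇒lev-⊢ m d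
  ... | k , d' = k , gen d'
  below-⊢⇒lev-⊢ m (nonemp χ)      = 0 , nonemp χ
  below-⊢⇒lev-⊢ m (eqRefl t)      = 0 , eqRefl t
  below-⊢⇒lev-⊢ m (eqSubst φ t u) = 0 , eqSubst φ t u

  Iter-closed : ∀ γ σ → Iter γ ⊢ σ → Iter γ σ
  Iter-closed (zero , zero)  σ d = ⊢-cut (λ σ x → x) d
  Iter-closed (suc m , zero) σ d with below-⊢⇒lev-⊢ m d
  ... | k , d' = lev⊆below m (suc k) σ (brk⊆lev-suc m k σ (⊢-mono (λ σ → inj₁) d'))
  Iter-closed (m , suc n)    σ d = brk⊆lev-suc m n σ (⊢-cut (lev-suc⊆brk m n) d)

  ¬∃P : ∀ j s → T (inTau F α (j ∷ s)) → Formula 0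
  ¬∃P j s h = ¬' (∃' (P j s h))

  -- Each P_(s⌢i) is refuted one stage before P_s.
  ¬∃P∈Iter-after-rk : ∀ δ → Acc _<o_ δ → ∀ j s h → rk α (j ∷ s) ≡ δ → Iter (sucO δ) (¬∃P j s h)
  ¬∃P∈Iter-after-rk (m , n) (acc rs) j s h e =
    brk⊆lev-suc m n _ (hyp₀ (inj₂ (P j s h , refl , P⇒U)))
    where
    P⇒U : ∀ i → lev m n ⊢ ∀' (P j s h ⇒ U i)
    P⇒U i with positive (rk α (j ∷ s)) in pos
    ... | false = hyp₀ (TAx⊆Iter (m , n) _ (ax-leaf j s h leaf i))
      where
      leaf : ∀ k → ¬ T (inTau F α (j ∷ s ++ [ k ]))
      leaf k hk = subst T pos (proj₂ (inTau-snoc⁻ α (j ∷ s) k hk))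
    ... | true = mp (hyp₀ (TAx⊆Iter (m , n) _ (ax-branch j s i child h)))
                    (hyp₀ (Iter-mono (<⇒sucO≤ child<) _ child-refuted))
      where
      s-positive : T (positive (rk α (j ∷ s)))
      s-positive = subst T (sym pos) tt
      child : T (inTau F α (j ∷ s ++ [ i ]))
      child = inTau-snoc⁺ α (j ∷ s) i h s-positive
      child< : childRank (rk α (j ∷ s)) i <o (m , n)
      child< = subst (childRank (rk α (j ∷ s)) i <o_) e (childRank-< _ i s-positive)
      child-refuted : Iter (sucO (childRank (rk α (j ∷ s)) i)) (¬∃P j (s ++ [ i ]) child)
      child-refuted = ¬∃P∈Iter-after-rk _ (rs child<) j (s ++ [ i ]) child (rk-snoc α (j ∷ s) i)

  ¬∃P∈Iter : ∀ j s h → Iter α (¬∃P j s h)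
  ¬∃P∈Iter j s h = Iter-mono (<⇒sucO≤ (rk-< α j s h)) _
    (¬∃P∈Iter-after-rk _ (<o-wellFounded _) j s h refl)

symbolSize : ∀ F α → Sym F α → ℕ
symbolSize F α (inj₁ (j , s , _)) = suc (sum (j ∷ s))
symbolSize F α (inj₂ i)           = suc i

module UpperBound (F : FundSeq) (α : Ord) where
  open TheoryT F α
  open Syntax (Sym F α)
  open Derivations (Sym F α)
  open Counting (Sym F α)
  open Iteration F α

  TAx⁺ : Theory
  TAx⁺ σ = TAx σ ⊎ (∃ λ j → ∃ λ s → Σ (T (inTau F α (j ∷ s))) λ h → σ ≡ ¬∃P j s h)

  TAx⁺⊆Iter : TAx⁺ ⊆ Iter α
  TAx⁺⊆Iter σ (inj₁ t)                 = TAx⊆Iter α σ t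
  TAx⁺⊆Iter σ (inj₂ (j , s , h , refl)) = ¬∃P∈Iter j s h

  IsU : ℕ → Sym F α → Set
  IsU N (inj₁ _) = ⊥
  IsU N (inj₂ i) = i ≡ N

  IsU? : ∀ N r → Dec (IsU N r)
  IsU? N (inj₁ _) = no λ ()
  IsU? N (inj₂ i) = i ≟ N

  open Rules {TAx⁺}

  P-vacuous : ∀ j s h (X : Formula 2) → TAx⁺ ⊢ ∀' (rel (inj₁ (j , s , h)) zero ⇒ X)
  P-vacuous j s h X = ⊩⇒⊢ (∀I (⇒I (⊥E (⇒E (lift (⊢-ren suc refuted)) (∃I zero (ass (here refl)))))))
    where
    refuted : TAx⁺ ⊢ close {1} (¬∃P j s h)
    refuted = hyp (inj₂ (j , s , h , refl))

  module AvoidU (N : ℕ) where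
    open Avoidance (Sym F α) (IsU? N) public

    bigUʸ : ℕ → Formula 2
    bigUʸ i = ren inject₁ (bigU i)

    bigU-avoid : ∀ i → TAx⁺ ⊢ avoidingʸ (bigUʸ i) ⇒ avoid (suc zero) (bigUʸ i)
    bigU-avoid zero    = avoid-atom-intro (inj₂ 0) zero (suc zero)
    bigU-avoid (suc i) = ⊩⇒⊢ (⇒I (∧I (⇒E⊢ (bigU-avoid i) (∧I (∧E₁ (∧E₁ H)) (∧E₂ H)))
      (⇒E⊢ (avoid-atom-intro (inj₂ (suc i)) zero (suc zero)) (∧I (∧E₂ (∧E₁ H)) (∧E₂ H)))))
      where
      H : TAx⁺ ∣ [ avoidingʸ (bigUʸ (suc i)) ] ⊩ avoidingʸ (bigUʸ (suc i))
      H = ass (here refl)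

    bigU-suc-avoid : ∀ i → TAx⁺ ⊢ avoidingʸ (bigUʸ (suc i)) ⇒ avoid (suc zero) (bigUʸ i)
    bigU-suc-avoid i = ⊩⇒⊢ (⇒I (⇒E⊢ (bigU-avoid i) (∧I (∧E₁ (∧E₁ H)) (∧E₂ H))))
      where
      H : TAx⁺ ∣ [ avoidingʸ (bigUʸ (suc i)) ] ⊩ avoidingʸ (bigUʸ (suc i))
      H = ass (here refl)

    atLeast-avoid : ∀ i → TAx⁺ ⊢ avoid zero (close {1} (atLeast i (bigU i)))
    atLeast-avoid i = subst (TAx⁺ ⊢_)
      (sym (trans (cong (avoid zero) (close-atLeast i (bigU i))) (avoid-atLeastʸ (bigUʸ i) 0 i)))
      (⊩⇒⊢ (atLeastʸ-mono (bigU-suc-avoid i) 0 i (atLeastʸ-avoid (bigUʸ (suc i)) i 0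
        (lift (subst (TAx⁺ ⊢_) (close-atLeast (suc i) (bigU (suc i)))
          (hyp (inj₁ (ax-inf (suc i)))))))))

    TAx⁺-avoid-closed : AvoidClosed TAx⁺
    TAx⁺-avoid-closed σ (inj₂ (j , s , h , refl))      = hyp (inj₂ (j , s , h , refl))
    TAx⁺-avoid-closed σ (inj₁ (ax-branch j s i h₁ h₂)) = mp (axK _ _) (P-vacuous j s h₂ _)
    TAx⁺-avoid-closed σ (inj₁ (ax-leaf j s h leaf i))  = P-vacuous j s h _
    TAx⁺-avoid-closed σ (inj₁ (ax-inf i))              = atLeast-avoid i

  TAx⁺-p-closed : ∀ ψ → (∀ i → TAx⁺ ⊢ ∀' (ψ ⇒ U i)) → TAx⁺ ⊢ ¬' (∃' ψ)
  TAx⁺-p-closed ψ ψ⇒U =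
    ¬∃-by-avoidance TAx⁺-avoid-closed ψ
      (AllSymbols-map small⇒¬IsU ψ (symbolBound-AllSymbols (symbolSize F α) ψ ≤-refl))
      (inj₂ N) refl (ψ⇒U N)
    where
    N : ℕ
    N = symbolBound (symbolSize F α) ψ
    open AvoidU N
    small⇒¬IsU : ∀ {r} → symbolSize F α r ≤ N → ¬ IsU N r
    small⇒¬IsU {inj₂ i} p refl = <-irrefl refl p

  lev⊆ThTAx⁺ : ∀ m n σ → lev m n σ → TAx⁺ ⊢ σ
  below⊆ThTAx⁺ : ∀ m σ → below m σ → TAx⁺ ⊢ σ
  lev⊆ThTAx⁺ zero    zero    σ x = ⊢-cut (λ σ t → hyp₀ (inj₁ t)) x
  lev⊆ThTAx⁺ (suc m) zero    σ x = below⊆ThTAx⁺ m σ x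
  lev⊆ThTAx⁺ m       (suc n) σ x = ⊢-cut step (lev-suc⊆brk m n σ x)
    where
    step : ∀ σ → lev m n σ ⊎ Pp (lev m n) σ → TAx⁺ ⊢ σ
    step σ (inj₁ y)                = lev⊆ThTAx⁺ m n σ y
    step σ (inj₂ (ψ , refl , ψ⇒U)) = TAx⁺-p-closed ψ (λ i → ⊢-cut (lev⊆ThTAx⁺ m n) (ψ⇒U i))
  below⊆ThTAx⁺ zero    σ (n , x)        = lev⊆ThTAx⁺ zero n σ x
  below⊆ThTAx⁺ (suc m) σ (inj₁ x)       = below⊆ThTAx⁺ m σ x
  below⊆ThTAx⁺ (suc m) σ (inj₂ (n , x)) = lev⊆ThTAx⁺ (suc m) n σ x

  Iter⊆Iter-α : ∀ β → Iter β ⊆ Iter α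
  Iter⊆Iter-α (m , n) σ x =
    Iter-closed α σ (⊢-cut (λ σ y → hyp₀ (TAx⁺⊆Iter σ y)) (lev⊆ThTAx⁺ m n σ x))

record Structure : Set₁ where
  field
    Uᴹ : ℕ → ℕ → Set
    Pᴹ : List ℕ → ℕ → Set

module LowerBound (F : FundSeq) (α : Ord) where
  open TheoryT F α
  open Syntax (Sym F α)
  open Semantics (Sym F α)
  open Rank F
  open Iteration F α

  interp : Structure → Sym F α → ℕ → Set
  interp M (inj₁ (j , s , _)) = Structure.Pᴹ M (j ∷ s)
  interp M (inj₂ i)           = Structure.Uᴹ M i

  infix 2 _⊨_
  _⊨_ : Structure → Theory → Set
  M ⊨ S = Interpretation.Valid (interp M) S

  record Good (β : Ord) (M : Structure) : Set where
    open Structure M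
    field
      rank-≥ : ∀ t x → Pᴹ t x → β ≤o rk α t
      branch : ∀ t x i → Pᴹ t x → ¬ Uᴹ i x → T (inTau F α (t ++ [ i ])) →
               ¬ ¬ (∃ λ y → Pᴹ (t ++ [ i ]) y)
      leaf   : ∀ t x i → Pᴹ t x → T (inTau F α t) → (∀ k → ¬ T (inTau F α (t ++ [ k ]))) →
               ¬ ¬ Uᴹ i x
      fresh  : ∀ xs → ¬ ¬ (∃ λ x → x ∉ xs × (∀ i → Uᴹ i x))

  Good-≤ : ∀ {β β' M} → β' ≤o β → Good β M → Good β' M
  Good-≤ β'≤β good = record
    { rank-≥ = λ t x p → ≤o-trans β'≤β (rank-≥ t x p)
    ; branch = branch
    ; leaf   = leaf
    ; fresh  = fresh }
    where open Good good

  module _ (M : Structure) {β} (good : Good β M) where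
    open Structure M
    open Good good
    open Interpretation (interp M)

    private
      ⟦bigU⟧ : ∀ i e → (∀ j → Uᴹ j (e zero)) → ⟦ bigU i ⟧ e
      ⟦bigU⟧ zero    e u = λ ¬u → ¬u (u 0)
      ⟦bigU⟧ (suc i) e u = ⟦∧⟧⁺ (bigU i) (U (suc i)) (⟦bigU⟧ i e u) (λ ¬u → ¬u (u (suc i)))

      ⟦neqAll⟧ : ∀ k d (e : Fin k → ℕ) → (∀ j → d ≢ e j) → ⟦ neqAll k ⟧ (d ∷ₑ e)
      ⟦neqAll⟧ k d e d≢e = go (allFin k)
        where
        go : (l : List (Fin k)) → ⟦ neqList l ⟧ (d ∷ₑ e)
        go []      = λ z → z
        go (j ∷ l) = ⟦∧⟧⁺ (¬' (zero ≐ suc j)) _ (d≢e j) (go l)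

      ⟦atLeastGo⟧ : ∀ i k r (e : Fin k → ℕ) → ⟦ atLeastGo (bigU i) k r ⟧ e
      ⟦atLeastGo⟧ i k zero    e = λ z → z
      ⟦atLeastGo⟧ i k (suc r) e ∀¬ = fresh (map e (allFin k)) λ { (d , d∉ , u) → ∀¬ d
        (⟦∧⟧⁺ (neqAll k) (ren (λ _ → zero) (bigU i) ∧' atLeastGo (bigU i) (suc k) r)
          (⟦neqAll⟧ k d e λ j d≡ →
            d∉ (subst (_∈ map e (allFin k)) (sym d≡) (∈-map⁺ e (∈-allFin j))))
          (⟦∧⟧⁺ (ren (λ _ → zero) (bigU i)) (atLeastGo (bigU i) (suc k) r)
            (⟦ren⟧⁺ (λ _ → zero) (bigU i) (d ∷ₑ e) (⟦bigU⟧ i _ u))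
            (⟦atLeastGo⟧ i (suc k) r (d ∷ₑ e)))) }

    ⊨TAx : M ⊨ TAx
    ⊨TAx _ (ax-branch j s i h₁ h₂) = λ ¬∃ d Pd ¬U →
      Pd (λ p → branch (j ∷ s) d i p ¬U h₁ (λ { (y , py) → ¬∃ (λ ∀¬ → ∀¬ y (λ ¬p → ¬p py)) }))
    ⊨TAx _ (ax-leaf j s h isLeaf i) = λ d Pd ¬U → Pd (λ p → leaf (j ∷ s) d i p h isLeaf ¬U)
    ⊨TAx _ (ax-inf i)               = ⟦atLeastGo⟧ i 0 i ε₀

  -- Given a ⊨ ψ, remove a from U_N and add a new element b to every P_(t⌢N) of rank ≥ (m, n).
  -- For N large the result is Good (m, n) and agrees with M on ψ, yet ψ(a) → U_N(a) fails there.
  module SuccessorStep (m n : ℕ) (M : Structure) (good : Good (m , suc n) M)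
                       (IH : ∀ M' → Good (m , n) M' → M' ⊨ lev m n)
                       (ψ : Formula 1) (ψ⇒U : ∀ i → lev m n ⊢ ∀' (ψ ⇒ U i)) where
    open Structure M
    open Good good

    N : ℕ
    N = symbolBound (symbolSize F α) ψ + cofinalityBound (m , n) (proj₁ α)

    module Modified (a b : ℕ) (b≢a : b ≢ a) (Ub : ∀ i → Uᴹ i b) where

      M' : Structure
      M' = record
        { Uᴹ = λ i x → Uᴹ i x × (i ≡ N → x ≢ a)
        ; Pᴹ = λ t x → Pᴹ t x ⊎ (x ≡ b × (∃ λ t₀ → t ≡ t₀ ++ [ N ]) × (m , n) ≤o rk α t) }

      old-witness : ∀ t' → ∃ (Pᴹ t') → ∃ (Structure.Pᴹ M' t')
      old-witness t' (y , py) = y , inj₁ py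

      good' : Good (m , n) M'
      Good.rank-≥ good' t x (inj₁ p)           = ≤o-trans (inj₁ (<o-sucO (m , n))) (rank-≥ t x p)
      Good.rank-≥ good' t x (inj₂ (_ , _ , q)) = q
      Good.branch good' t x i (inj₁ p) ¬U' h with i ≟ N | x ≟ a
      ... | yes refl | yes refl = λ ¬∃ → ¬∃ (b , inj₂ (refl , (t , refl) ,
              rk-snoc-large α t N (rank-≥ t x p) (m≤n+m _ _)))
      ... | yes refl | no x≢a   = λ ¬∃ →
              branch t x i p (λ u → ¬U' (u , λ _ → x≢a)) h (λ w → ¬∃ (old-witness _ w))
      ... | no i≢N   | _        = λ ¬∃ →
              branch t x i p (λ u → ¬U' (u , λ i≡N → ⊥-elim (i≢N i≡N))) h
                (λ w → ¬∃ (old-witness _ w))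
      Good.branch good' t x i (inj₂ (refl , _ , _)) ¬U' h = ⊥-elim (¬U' (Ub i , λ _ → b≢a))
      Good.leaf good' t x i (inj₁ p) h isLeaf = ⊥-elim (isLeaf 0
        (inTau-snoc⁺ α t 0 h (<o⇒positive (<-≤o-trans (<o-sucO (m , n)) (rank-≥ t x p)))))
      Good.leaf good' t x i (inj₂ (refl , _ , _)) h isLeaf = λ ¬U' → ¬U' (Ub i , λ _ → b≢a)
      Good.fresh good' xs = λ ¬∃ → fresh (a ∷ xs) λ { (x , x∉ , u) →
        ¬∃ (x , (λ q → x∉ (there q)) , λ i → u i , λ _ x≡a → x∉ (here x≡a)) }

      agree : ∀ r → symbolSize F α r ≤ N → ∀ x →
              (interp M r x → interp M' r x) × (interp M' r x → interp M r x)
      agree (inj₂ i) i<N x = (λ u → u , λ i≡N → ⊥-elim (<-irrefl i≡N i<N)) , proj₁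
      agree (inj₁ (j , s , h)) size≤N x = inj₁ , λ
        { (inj₁ p)                     → p
        ; (inj₂ (_ , (t₀ , j∷s≡) , _)) → ⊥-elim (<-irrefl refl (≤-trans
            (s≤s (∈⇒≤sum (subst (N ∈_) (sym j∷s≡) (∈-++⁺ʳ t₀ (here refl))))) size≤N)) }

      ψa-impossible : Interpretation.⟦_⟧ (interp M) ψ (a ∷ₑ ε₀) → ⊥
      ψa-impossible ψa =
        Interpretation.soundness (interp M') (IH M' good') (ψ⇒U N) ε₀ a
          (Agreement.agree⁺ (interp M) (interp M') _ agree ψ
            (symbolBound-AllSymbols (symbolSize F α) ψ (m≤m+n _ _)) (a ∷ₑ ε₀) ψa)
          (λ U'a → proj₂ U'a refl refl)

    ⊨¬∃ψ : Interpretation.⟦_⟧ (interp M) (¬' (∃' ψ)) ε₀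
    ⊨¬∃ψ ∃ψ = ∃ψ λ a ψa → fresh [ a ] λ { (b , b∉ , Ub) →
      Modified.ψa-impossible a b (λ b≡a → b∉ (here b≡a)) Ub ψa }

  Good⇒⊨lev : ∀ m n M → Good (m , n) M → M ⊨ lev m n
  Good⇒⊨below : ∀ m M → Good (suc m , 0) M → M ⊨ below m
  Good⇒⊨lev zero    zero    M good σ x = Interpretation.soundness (interp M) (⊨TAx M good) x ε₀
  Good⇒⊨lev (suc m) zero    M good     = Good⇒⊨below m M good
  Good⇒⊨lev m       (suc n) M good σ x =
    Interpretation.soundness (interp M) ⊨brk (lev-suc⊆brk m n σ x) ε₀
    where
    ⊨brk : M ⊨ (λ σ → lev m n σ ⊎ Pp (lev m n) σ)
    ⊨brk σ (inj₁ y)                = Good⇒⊨lev m n M (Good-≤ (inj₁ (<o-sucO (m , n))) good) σ y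
    ⊨brk σ (inj₂ (ψ , refl , ψ⇒U)) =
      SuccessorStep.⊨¬∃ψ m n M good (λ M' → Good⇒⊨lev m n M') ψ ψ⇒U
  Good⇒⊨below zero    M good σ (n , x)        =
    Good⇒⊨lev zero n M (Good-≤ (inj₁ (lt₁ (s≤s z≤n))) good) σ x
  Good⇒⊨below (suc m) M good σ (inj₁ x)       =
    Good⇒⊨below m M (Good-≤ (inj₁ (lt₁ (n<1+n (suc m)))) good) σ x
  Good⇒⊨below (suc m) M good σ (inj₂ (n , x)) =
    Good⇒⊨lev (suc m) n M (Good-≤ (inj₁ (lt₁ (n<1+n (suc m)))) good) σ x

  M₀ : Ord → Structure
  M₀ β = record { Uᴹ = λ _ _ → ⊤ ; Pᴹ = λ t _ → β ≤o rk α t }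

  M₀-good : ∀ β → Good β (M₀ β)
  M₀-good β = record
    { rank-≥ = λ t x p → p
    ; branch = λ t x i p ¬U _ → ⊥-elim (¬U tt)
    ; leaf   = λ _ _ _ _ _ _ ¬U → ¬U tt
    ; fresh  = λ xs ¬∃ → ¬∃ (suc (sum xs) , (λ q → <-irrefl refl (∈⇒≤sum q)) , λ _ → tt) }

  Iter-α⊈Iter : ∀ β → β <o α → ¬ (Iter α ⊆ Iter β)
  Iter-α⊈Iter β β<α incl with nodeOfRank α (<o-wellFounded α) β β<α
  ... | j , s , h , rk≡β =
    Good⇒⊨lev (proj₁ β) (proj₂ β) (M₀ β) (M₀-good β) _ (incl _ (¬∃P∈Iter j s h))
      (λ ∀¬P → ∀¬P 0 (λ ¬P → ¬P (subst (β ≤o_) (sym rk≡β) ≤o-refl)))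

mainTheorem17 : (F : FundSeq) (α : Ord) →
    let open TheoryT F α in
    (∀ β → α ≤o β → Iter β ⊆ Iter α) × (∀ β → β <o α → ¬ (Iter α ⊆ Iter β))
mainTheorem17 F α = (λ β _ → UpperBound.Iter⊆Iter-α F α β) , LowerBound.Iter-α⊈Iter F α
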